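{- For every real number $d$ and every integer $n \geq 1$, \[ s_d(n) = c^V_{d,d+1}(n). \]
   Context: A Schröder tree is a plane (ordered) rooted tree in which every internal node (non-leaf) has at least two children; the single-node tree has one leaf and no internal nodes. Let $s(n,k)$ be the number of Schröder trees with $n$ leaves and $k$ internal nodes, and for real $d$ let $s_d(n) = \sum_{k=0}^{n-1} s(n,k) d^k$ (convention $0^0=1$). Let $\mathcal{D}_n$ be the set of Dyck paths from $(0,0)$ to $(2n-2,0)$, i.e. lattice paths with steps $U=(1,1)$ and $D=(1,-1)$ never going below the $x$-axis (for $n=1$, only the empty path). For $P \in \mathcal{D}_n$, a valley is an occurrence of two consecutive steps $DU$; $V(P)$ is the number of valleys of $P$, and $U_V(P)$ is the number of up steps of $P$ that are not the $U$ of a valley. For real $a,b$, define $c^V_{a,b}(n) = \sum_{P \in \mathcal{D}_n} a^{U_V(P)} b^{V(P)}$ (convention $0^0=1$). -}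

module Defs where

open import Level using (Level)
open import Data.Nat using (ℕ; zero; suc; _∸_) renaming (_+_ to _+ℕ_; _*_ to _*ℕ_)
open import Data.Bool using (Bool; true; false; _∧_; not)
open import Data.List using (List; []; _∷_; map; _++_; filter; foldr; length)
open import Data.Product using (Σ; _×_)
open import Relation.Binary.PropositionalEquality using (_≡_)
open import Relation.Nullary.Decidable using (Dec; yes; no)
open import Data.Bool.Properties using () renaming (_≟_ to _≟ᵇ_)
open import Algebra.Bundles using (CommutativeRing; Semiring)

data Tree : Set where
  node : List Tree → Tree

mutual
  leaves : Tree → ℕ
  leaves (node []) = 1
  leaves (node (t ∷ ts)) = leavesL (t ∷ ts)

  leavesL : List Tree → ℕ
  leavesL [] = 0
  leavesL (t ∷ ts) = leaves t +ℕ leavesL ts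

mutual
  internals : Tree → ℕ
  internals (node []) = 0
  internals (node (t ∷ ts)) = suc (internalsL (t ∷ ts))

  internalsL : List Tree → ℕ
  internalsL [] = 0
  internalsL (t ∷ ts) = internals t +ℕ internalsL ts

atLeastTwo : List Tree → Bool
atLeastTwo (_ ∷ _ ∷ _) = true
atLeastTwo _ = false

mutual
  isSchröder : Tree → Bool
  isSchröder (node []) = true
  isSchröder (node (t ∷ ts)) = atLeastTwo (t ∷ ts) ∧ allSchröder (t ∷ ts)

  allSchröder : List Tree → Bool
  allSchröder [] = true
  allSchröder (t ∷ ts) = isSchröder t ∧ allSchröder ts

SchröderTrees : ℕ → ℕ → Set
SchröderTrees n k =
  Σ Tree (λ t → (isSchröder t ≡ true) × (leaves t ≡ n) × (internals t ≡ k))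

data Step : Set where
  U D : Step

words : ℕ → List (List Step)
words zero = [] ∷ []
words (suc m) = map (U ∷_) (words m) ++ map (D ∷_) (words m)

dyckFrom : ℕ → List Step → Bool
dyckFrom zero [] = true
dyckFrom (suc _) [] = false
dyckFrom h (U ∷ w) = dyckFrom (suc h) w
dyckFrom zero (D ∷ w) = false
dyckFrom (suc h) (D ∷ w) = dyckFrom h w

isDyck : List Step → Bool
isDyck = dyckFrom 0

isDyck? : (w : List Step) → Dec (isDyck w ≡ true)
isDyck? w = isDyck w ≟ᵇ true

dyckPaths : ℕ → List (List Step)
dyckPaths n = filter isDyck? (words (2 *ℕ (n ∸ 1)))

valleys : List Step → ℕ
valleys [] = 0
valleys (D ∷ U ∷ w) = suc (valleys (U ∷ w))
valleys (_ ∷ w) = valleys w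

upsNotValley : List Step → ℕ
upsNotValley = go false
  where
  -- flag: the previous step was D
  go : Bool → List Step → ℕ
  go _ [] = 0
  go true (U ∷ w) = go false w
  go false (U ∷ w) = suc (go false w)
  go _ (D ∷ w) = go true w

module _ {c ℓ : Level} (R : CommutativeRing c ℓ) where
  open CommutativeRing R
  open import Algebra.Definitions.RawSemiring (Semiring.rawSemiring semiring) using (_^_) renaming (_×_ to _·ℕ_)

  sumBelow : ℕ → (ℕ → Carrier) → Carrier
  sumBelow zero f = 0#
  sumBelow (suc m) f = sumBelow m f + f m

  sPoly : (ℕ → ℕ → ℕ) → Carrier → ℕ → Carrier
  sPoly s d n = sumBelow n (λ k → s n k ·ℕ (d ^ k))

  cV : Carrier → Carrier → ℕ → Carrier
  cV a b n = foldr (λ P acc → (a ^ upsNotValley P) * (b ^ valleys P) + acc) 0# (dyckPaths n)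

-- A Schröder tree is a leaf, a root with exactly two subtrees, or a first subtree beside
-- the tree formed by the remaining (at least two) children, which reuses the root. Hence
-- F u = s_d(u + 1) satisfies F 0 = 1 and
--   F (u + 1) = d Σ_{i+j=u} F i F j + Σ_{i+j=u} F i F⁺ j,
-- where F⁺ is F with F 0 replaced by 0; this recurrence determines F.
-- Weight a Dyck path step by step: a U step gets d, or d + 1 when it closes a valley.
-- Cutting paths at their first return to the axis, the sums G u and G′ u over paths with
-- u up steps, started afresh or right after a D step, satisfy G (u + 1) = d Σ G i G′ j and
-- G′ (u + 1) = (d + 1) Σ G i G′ j. So d G′ = d G + G⁺, and G satisfies the recurrence of F.
module Submission where

open import Defs
open import Level using (Level)
open import Algebra.Bundles using (CommutativeRing; Semiring)
open import Data.Nat using (ℕ; zero; suc; _≤_; _<_; z≤n; s≤s) renaming (_+_ to _+ℕ_; _*_ to _*ℕ_)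
import Data.Nat.Properties as ℕ
open import Data.Bool using (Bool; true; false; _∧_; if_then_else_)
open import Data.List using (List; []; _∷_; length; map; _++_; foldr; filter)
open import Data.Product using (Σ-syntax; _×_; _,_)
open import Data.Sum using (_⊎_; inj₁; inj₂)
open import Data.Empty using (⊥; ⊥-elim)
open import Data.Fin using (Fin)
import Data.Fin as Fin
open import Data.Fin.Properties using (+↔⊎; *↔×)
open import Data.Fin.Permutation using (↔⇒≡)
open import Function.Bundles using (_↔_; mk↔ₛ′)
open import Function.Construct.Composition using (_↔-∘_)
open import Function.Construct.Symmetry using (↔-sym)
open import Data.Sum.Function.Propositional using (_⊎-cong_)
open import Data.Product.Function.NonDependent.Propositional using (_×-cong_)
open import Axiom.UniquenessOfIdentityProofs.WithK using (uip)
open import Data.Nat.Tactic.RingSolver using (solve-∀)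
open import Relation.Nullary using (Irrelevant)
open import Function using (_∘_)
open import Data.Bool.Properties using (∧-conicalˡ; ∧-conicalʳ)
open import Relation.Binary.PropositionalEquality using (_≡_; refl; sym; trans; cong; cong₂; subst; subst₂)

Conv : (ℕ → ℕ → Set) → ℕ → Set
Conv P u = Σ[ i ∈ ℕ ] Σ[ j ∈ ℕ ] (i +ℕ j ≡ u) × P i j

convℕ : (ℕ → ℕ → ℕ) → ℕ → ℕ
convℕ p zero = p 0 0
convℕ p (suc u) = p 0 (suc u) +ℕ convℕ (λ i → p (suc i)) u

pairCount : (ℕ → ℕ → ℕ) → (ℕ → ℕ → ℕ) → ℕ → ℕ → ℕ
pairCount p q n k = convℕ (λ i j → convℕ (λ a b → p i a *ℕ q j b) k) n

Conv-zero : ∀ P → Conv P 0 ↔ P 0 0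
Conv-zero P = mk↔ₛ′ to (λ x → 0 , 0 , refl , x) (λ _ → refl) from∘to
  where
  to : Conv P 0 → P 0 0
  to (zero , zero , refl , x) = x
  from∘to : ∀ z → (0 , 0 , refl , to z) ≡ z
  from∘to (zero , zero , refl , x) = refl

Conv-suc : ∀ P u → Conv P (suc u) ↔ (P 0 (suc u) ⊎ Conv (λ i → P (suc i)) u)
Conv-suc P u = mk↔ₛ′ to from to∘from from∘to
  where
  to : Conv P (suc u) → P 0 (suc u) ⊎ Conv (λ i → P (suc i)) u
  to (zero , j , refl , x) = inj₁ x
  to (suc i , j , e , x) = inj₂ (i , j , ℕ.suc-injective e , x)
  from : P 0 (suc u) ⊎ Conv (λ i → P (suc i)) u → Conv P (suc u)
  from (inj₁ x) = 0 , suc u , refl , x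
  from (inj₂ (i , j , e , x)) = suc i , j , cong suc e , x
  to∘from : ∀ y → to (from y) ≡ y
  to∘from (inj₁ x) = refl
  to∘from (inj₂ (i , j , e , x)) = cong (λ e′ → inj₂ (i , j , e′ , x)) (uip _ _)
  from∘to : ∀ y → from (to y) ≡ y
  from∘to (zero , j , refl , x) = refl
  from∘to (suc i , j , e , x) = cong (λ e′ → suc i , j , e′ , x) (uip _ _)

Conv↔Fin : ∀ {P : ℕ → ℕ → Set} {p : ℕ → ℕ → ℕ} → (∀ i j → P i j ↔ Fin (p i j))
  → ∀ u → Conv P u ↔ Fin (convℕ p u)
Conv↔Fin {P} counted zero = counted 0 0 ↔-∘ Conv-zero P
Conv↔Fin {P} counted (suc u) =
  ↔-sym +↔⊎ ↔-∘ ((counted 0 (suc u) ⊎-cong Conv↔Fin (λ i → counted (suc i)) u) ↔-∘ Conv-suc P u)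

empty↔Fin0 : {A : Set} → (A → ⊥) → A ↔ Fin 0
empty↔Fin0 ¬a = mk↔ₛ′ (λ a → ⊥-elim (¬a a)) (λ ()) (λ ()) (λ a → ⊥-elim (¬a a))

IsSchröder : Tree → Set
IsSchröder t = isSchröder t ≡ true

hasChildren : Tree → Bool
hasChildren (node []) = false
hasChildren (node (_ ∷ _)) = true

IsBranching : Tree → Set
IsBranching t = IsSchröder t × hasChildren t ≡ true

Sized : (Tree → Set) → ℕ → ℕ → Set
Sized P n k = Σ[ t ∈ Tree ] P t × leaves t ≡ n × internals t ≡ k

-- r is the number of internal nodes created when the pair is joined into one tree.
TreePairs : ℕ → (Tree → Set) → (Tree → Set) → ℕ → ℕ → Set
TreePairs r P Q n k = Σ[ t ∈ Tree ] Σ[ t′ ∈ Tree ]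
  (P t × Q t′) × (leaves t +ℕ leaves t′ ≡ n) × (r +ℕ (internals t +ℕ internals t′) ≡ k)

TreePairs↔Conv : ∀ P Q n k
  → TreePairs 0 P Q n k ↔ Conv (λ i j → Conv (λ a b → Sized P i a × Sized Q j b) k) n
TreePairs↔Conv P Q n k = mk↔ₛ′ to from to∘from (λ _ → refl)
  where
  to : TreePairs 0 P Q n k → Conv (λ i j → Conv (λ a b → Sized P i a × Sized Q j b) k) n
  to (t , t′ , (p , q) , l , i) =
    leaves t , leaves t′ , l , internals t , internals t′ , i , (t , p , refl , refl) , (t′ , q , refl , refl)
  from : Conv (λ i j → Conv (λ a b → Sized P i a × Sized Q j b) k) n → TreePairs 0 P Q n k
  from (_ , _ , l , _ , _ , i , (t , p , refl , refl) , (t′ , q , refl , refl)) = t , t′ , (p , q) , l , i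
  to∘from : ∀ z → to (from z) ≡ z
  to∘from (_ , _ , l , _ , _ , i , (t , p , refl , refl) , (t′ , q , refl , refl)) = refl

SchröderShape : ℕ → ℕ → Set
SchröderShape n k =
  (1 ≡ n × 0 ≡ k) ⊎ TreePairs 1 IsSchröder IsSchröder n k ⊎ TreePairs 0 IsSchröder IsBranching n k

∧-true : ∀ {x y} → x ≡ true → y ≡ true → x ∧ y ≡ true
∧-true refl q = q

decompose : ∀ {n k} → SchröderTrees n k → SchröderShape n k
decompose (node [] , _ , l , i) = inj₁ (l , i)
decompose (node (_ ∷ []) , () , _)
decompose (node (t ∷ t′ ∷ []) , s , l , i) =
  inj₂ (inj₁ (t , t′ ,
    (∧-conicalˡ (isSchröder t) _ s , ∧-conicalˡ (isSchröder t′) _ (∧-conicalʳ (isSchröder t) _ s)) ,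
    trans (cong (leaves t +ℕ_) (sym (ℕ.+-identityʳ _))) l ,
    trans (cong (λ m → suc (internals t +ℕ m)) (sym (ℕ.+-identityʳ _))) i))
decompose (node (t ∷ t′ ∷ t″ ∷ ts) , s , l , i) =
  inj₂ (inj₂ (t , node (t′ ∷ t″ ∷ ts) ,
    (∧-conicalˡ (isSchröder t) _ s , ∧-conicalʳ (isSchröder t) _ s , refl) , l , trans (ℕ.+-suc _ _) i))

compose : ∀ {n k} → SchröderShape n k → SchröderTrees n k
compose (inj₁ (refl , refl)) = node [] , refl , refl , refl
compose (inj₂ (inj₁ (t , t′ , (s , s′) , l , i))) =
  node (t ∷ t′ ∷ []) , ∧-true s (∧-true s′ refl) ,
    trans (cong (leaves t +ℕ_) (ℕ.+-identityʳ _)) l ,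
    trans (cong (λ m → suc (internals t +ℕ m)) (ℕ.+-identityʳ _)) i
compose (inj₂ (inj₂ (t , node (t′ ∷ t″ ∷ ts) , (s , s′ , _) , l , i))) =
  node (t ∷ t′ ∷ t″ ∷ ts) , ∧-true s s′ , l , trans (sym (ℕ.+-suc _ _)) i

Sized-≡ : ∀ {P : Tree → Set} → (∀ {t} → Irrelevant (P t))
  → ∀ {n k t} {x y : P t × leaves t ≡ n × internals t ≡ k}
  → _≡_ {A = Sized P n k} (t , x) (t , y)
Sized-≡ P-irr {x = p , l , i} {p′ , l′ , i′} with P-irr p p′ | uip l l′ | uip i i′
... | refl | refl | refl = refl

TreePairs-≡ : ∀ {r} {P Q : Tree → Set} → (∀ {t} → Irrelevant (P t)) → (∀ {t} → Irrelevant (Q t))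
  → ∀ {n k t t′}
    {x y : (P t × Q t′) × (leaves t +ℕ leaves t′ ≡ n) × (r +ℕ (internals t +ℕ internals t′) ≡ k)}
  → _≡_ {A = TreePairs r P Q n k} (t , t′ , x) (t , t′ , y)
TreePairs-≡ P-irr Q-irr {x = (p , q) , l , i} {(p′ , q′) , l′ , i′}
  with P-irr p p′ | Q-irr q q′ | uip l l′ | uip i i′
... | refl | refl | refl | refl = refl

IsBranching-irrelevant : ∀ {t} → Irrelevant (IsBranching t)
IsBranching-irrelevant (s , b) (s′ , b′) = cong₂ _,_ (uip s s′) (uip b b′)

SchröderTrees↔Shape : ∀ n k → SchröderTrees n k ↔ SchröderShape n k
SchröderTrees↔Shape n k = mk↔ₛ′ decompose compose decompose∘compose compose∘decompose
  where
  compose∘decompose : ∀ {n k} (x : SchröderTrees n k) → compose (decompose x) ≡ x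
  compose∘decompose (node [] , refl , refl , refl) = refl
  compose∘decompose (node (_ ∷ []) , () , _)
  compose∘decompose (node (_ ∷ _ ∷ []) , _ , _ , _) = Sized-≡ uip
  compose∘decompose (node (_ ∷ _ ∷ _ ∷ _) , _ , _ , _) = Sized-≡ uip
  decompose∘compose : ∀ {n k} (x : SchröderShape n k) → decompose (compose x) ≡ x
  decompose∘compose (inj₁ (refl , refl)) = refl
  decompose∘compose (inj₂ (inj₁ _)) = cong (inj₂ ∘ inj₁) (TreePairs-≡ {1} uip uip)
  decompose∘compose (inj₂ (inj₂ (_ , node [] , (_ , _ , ()) , _)))
  decompose∘compose (inj₂ (inj₂ (_ , node (_ ∷ []) , (_ , () , _) , _)))
  decompose∘compose (inj₂ (inj₂ (_ , node (_ ∷ _ ∷ _) , _))) =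
    cong (inj₂ ∘ inj₂) (TreePairs-≡ {0} uip IsBranching-irrelevant)

leaves-positive : ∀ t → 1 ≤ leaves t
leaves-positive (node []) = s≤s z≤n
leaves-positive (node (t ∷ _)) = ℕ.≤-trans (leaves-positive t) (ℕ.m≤m+n _ _)

branching-leaves : ∀ t → IsBranching t → 2 ≤ leaves t
branching-leaves (node (_ ∷ [])) (() , _)
branching-leaves (node (t ∷ t′ ∷ _)) _ =
  ℕ.+-mono-≤ (leaves-positive t) (ℕ.≤-trans (leaves-positive t′) (ℕ.m≤m+n _ _))

internals<leaves : ∀ t → IsSchröder t → internals t < leaves t
internalsL+length≤leavesL : ∀ ts → allSchröder ts ≡ true → internalsL ts +ℕ length ts ≤ leavesL ts
internals<leaves (node []) _ = s≤s z≤n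
internals<leaves (node (_ ∷ [])) ()
internals<leaves (node ts@(_ ∷ _ ∷ ts′)) s =
  ℕ.≤-trans (s≤s (s≤s (ℕ.m≤m+n (internalsL ts) (length ts′))))
    (subst (_≤ leavesL ts) (trans (ℕ.+-suc _ _) (cong suc (ℕ.+-suc _ _))) (internalsL+length≤leavesL ts s))
internalsL+length≤leavesL [] _ = z≤n
internalsL+length≤leavesL (t ∷ ts) s =
  subst (_≤ leaves t +ℕ leavesL ts) (shuffle (internals t) (internalsL ts) (length ts))
    (ℕ.+-mono-≤ (internals<leaves t (∧-conicalˡ (isSchröder t) _ s))
              (internalsL+length≤leavesL ts (∧-conicalʳ (isSchröder t) _ s)))
  where
  shuffle : ∀ a b c → suc a +ℕ (b +ℕ c) ≡ (a +ℕ b) +ℕ suc c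
  shuffle = solve-∀

leafCount : ℕ → ℕ → ℕ
leafCount 1 0 = 1
leafCount _ _ = 0

leaf↔Fin : ∀ n k → (1 ≡ n × 0 ≡ k) ↔ Fin (leafCount n k)
leaf↔Fin 1 0 =
  mk↔ₛ′ (λ _ → Fin.zero) (λ _ → refl , refl) (λ { Fin.zero → refl ; (Fin.suc ()) }) (λ { (refl , refl) → refl })
leaf↔Fin 0 _ = empty↔Fin0 λ ()
leaf↔Fin 1 (suc _) = empty↔Fin0 λ ()
leaf↔Fin (suc (suc _)) _ = empty↔Fin0 λ ()

TreePairs-rootless : ∀ P Q n → TreePairs 1 P Q n 0 → ⊥
TreePairs-rootless _ _ _ (_ , _ , _ , _ , ())

TreePairs-unroot : ∀ P Q n k → TreePairs 1 P Q n (suc k) ↔ TreePairs 0 P Q n k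
TreePairs-unroot P Q n k = mk↔ₛ′
  (λ (t , t′ , pq , l , i) → t , t′ , pq , l , ℕ.suc-injective i)
  (λ (t , t′ , pq , l , i) → t , t′ , pq , l , cong suc i)
  (λ (t , t′ , pq , l , i) → cong (λ e → t , t′ , pq , l , e) (uip _ _))
  (λ (t , t′ , pq , l , i) → cong (λ e → t , t′ , pq , l , e) (uip _ _))

module Counting (s : ℕ → ℕ → ℕ) (counts : ∀ n k → Fin (s n k) ↔ SchröderTrees n k) where

  s-vanishes : ∀ n k → n ≤ k → s n k ≡ 0
  s-vanishes n k n≤k = ↔⇒≡ (empty↔Fin0 no-tree ↔-∘ counts n k)
    where
    no-tree : SchröderTrees n k → ⊥
    no-tree (t , s , l , i) =
      ℕ.<-irrefl refl (ℕ.≤-trans (internals<leaves t s) (subst₂ _≤_ (sym l) (sym i) n≤k))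

  s⁺ : ℕ → ℕ → ℕ
  s⁺ (suc (suc j)) b = s (suc (suc j)) b
  s⁺ _ _ = 0

  s⁺-vanishes : ∀ n k → n ≤ k → s⁺ n k ≡ 0
  s⁺-vanishes 0 _ _ = refl
  s⁺-vanishes 1 _ _ = refl
  s⁺-vanishes (suc (suc n)) = s-vanishes (suc (suc n))

  Sized↔Fin : ∀ n k → Sized IsSchröder n k ↔ Fin (s n k)
  Sized↔Fin n k = ↔-sym (counts n k)

  Branching↔Fin : ∀ j b → Sized IsBranching j b ↔ Fin (s⁺ j b)
  Branching↔Fin 0 b = empty↔Fin0 λ (t , p , l , _) → ℕ.n≮0 (subst (2 ≤_) l (branching-leaves t p))
  Branching↔Fin 1 b = empty↔Fin0 λ (t , p , l , _) → ℕ.<-irrefl refl (subst (2 ≤_) l (branching-leaves t p))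
  Branching↔Fin (suc (suc j)) b =
    Sized↔Fin (suc (suc j)) b ↔-∘ mk↔ₛ′ forget remember (λ _ → refl) (λ _ → Sized-≡ IsBranching-irrelevant)
    where
    branching : ∀ t → leaves t ≡ suc (suc j) → hasChildren t ≡ true
    branching (node (_ ∷ _)) _ = refl
    forget : Sized IsBranching (suc (suc j)) b → Sized IsSchröder (suc (suc j)) b
    forget (t , (p , _) , l , i) = t , p , l , i
    remember : Sized IsSchröder (suc (suc j)) b → Sized IsBranching (suc (suc j)) b
    remember (t , p , l , i) = t , (p , branching t l) , l , i

  TreePairs↔Fin : ∀ {Q q} → (∀ j b → Sized Q j b ↔ Fin (q j b))
    → ∀ n k → TreePairs 0 IsSchröder Q n k ↔ Fin (pairCount s q n k)
  TreePairs↔Fin {Q} Q↔Fin n k =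
    Conv↔Fin (λ i j → Conv↔Fin (λ a b → ↔-sym *↔× ↔-∘ (Sized↔Fin i a ×-cong Q↔Fin j b)) k) n
      ↔-∘ TreePairs↔Conv IsSchröder Q n k

  binaryCount : ℕ → ℕ → ℕ
  binaryCount n zero = 0
  binaryCount n (suc k) = pairCount s s n k

  Binary↔Fin : ∀ n k → TreePairs 1 IsSchröder IsSchröder n k ↔ Fin (binaryCount n k)
  Binary↔Fin n zero = empty↔Fin0 (TreePairs-rootless _ _ n)
  Binary↔Fin n (suc k) = TreePairs↔Fin Sized↔Fin n k ↔-∘ TreePairs-unroot _ _ n k

  s-recursion : ∀ n k → s n k ≡ leafCount n k +ℕ (binaryCount n k +ℕ pairCount s s⁺ n k)
  s-recursion n k = ↔⇒≡ (↔-sym +↔⊎ ↔-∘ (shape↔Fin ↔-∘ (SchröderTrees↔Shape n k ↔-∘ counts n k)))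
    where
    shape↔Fin : SchröderShape n k ↔ (Fin (leafCount n k) ⊎ Fin (binaryCount n k +ℕ pairCount s s⁺ n k))
    shape↔Fin =
      leaf↔Fin n k ⊎-cong (↔-sym +↔⊎ ↔-∘ (Binary↔Fin n k ⊎-cong TreePairs↔Fin Branching↔Fin n k))

module Sums {c ℓ : Level} (R : CommutativeRing c ℓ) where
  open CommutativeRing R renaming (refl to ≈-refl; sym to ≈-sym; trans to ≈-trans)
  open import Algebra.Definitions.RawSemiring (Semiring.rawSemiring semiring) using (_^_) renaming (_×_ to _·ℕ_)
  open import Algebra.Properties.Semiring.Mult semiring using (×-homo-+; ×1-homo-*; ×-assoc-*)
  open import Relation.Binary.Reasoning.Setoid setoid
  open import Algebra.Properties.CommutativeSemigroup +-commutativeSemigroup using (interchange)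

  ∑< : ℕ → (ℕ → Carrier) → Carrier
  ∑< = sumBelow R

  ∑<-cong : ∀ m {f g : ℕ → Carrier} → (∀ k → f k ≈ g k) → ∑< m f ≈ ∑< m g
  ∑<-cong zero _ = ≈-refl
  ∑<-cong (suc m) f≈g = +-cong (∑<-cong m f≈g) (f≈g m)

  ∑<-zero : ∀ m {f : ℕ → Carrier} → (∀ k → f k ≈ 0#) → ∑< m f ≈ 0#
  ∑<-zero zero _ = ≈-refl
  ∑<-zero (suc m) f≈0 = ≈-trans (+-cong (∑<-zero m f≈0) (f≈0 m)) (+-identityˡ 0#)

  ∑<-+ : ∀ m (f g : ℕ → Carrier) → ∑< m (λ k → f k + g k) ≈ ∑< m f + ∑< m g
  ∑<-+ zero _ _ = ≈-sym (+-identityˡ 0#)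
  ∑<-+ (suc m) f g = begin
    ∑< m (λ k → f k + g k) + (f m + g m) ≈⟨ +-congʳ (∑<-+ m f g) ⟩
    (∑< m f + ∑< m g) + (f m + g m)      ≈⟨ interchange _ _ _ _ ⟩
    (∑< m f + f m) + (∑< m g + g m)      ∎

  ∑<-*ˡ : ∀ m x (f : ℕ → Carrier) → ∑< m (λ k → x * f k) ≈ x * ∑< m f
  ∑<-*ˡ zero x _ = ≈-sym (zeroʳ x)
  ∑<-*ˡ (suc m) x f = ≈-trans (+-congʳ (∑<-*ˡ m x f)) (≈-sym (distribˡ x _ _))

  ∑<-suc : ∀ m (f : ℕ → Carrier) → ∑< (suc m) f ≈ f 0 + ∑< m (f ∘ suc)
  ∑<-suc zero _ = ≈-trans (+-identityˡ _) (≈-sym (+-identityʳ _))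
  ∑<-suc (suc m) f = ≈-trans (+-congʳ (∑<-suc m f)) (+-assoc _ _ _)

  ∑<-extend : ∀ {m n} (f : ℕ → Carrier) → m ≤ n → (∀ k → m ≤ k → f k ≈ 0#) → ∑< n f ≈ ∑< m f
  ∑<-extend {n = zero} _ z≤n _ = ≈-refl
  ∑<-extend {m} {suc n} f m≤n f≈0 with ℕ.m≤n⇒m<n∨m≡n m≤n
  ... | inj₂ refl = ≈-refl
  ... | inj₁ (s≤s m≤n′) = ≈-trans (+-cong (∑<-extend f m≤n′ f≈0) (f≈0 n m≤n′)) (+-identityʳ _)

  conv : (ℕ → ℕ → Carrier) → ℕ → Carrier
  conv p zero = p 0 0
  conv p (suc u) = p 0 (suc u) + conv (λ i → p (suc i)) u

  conv-cong : ∀ u {p q : ℕ → ℕ → Carrier} → (∀ i j → i +ℕ j ≡ u → p i j ≈ q i j)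
    → conv p u ≈ conv q u
  conv-cong zero p≈q = p≈q 0 0 refl
  conv-cong (suc u) p≈q = +-cong (p≈q 0 (suc u) refl) (conv-cong u (λ i j e → p≈q (suc i) j (cong suc e)))

  conv-zero : ∀ u {p : ℕ → ℕ → Carrier} → (∀ i j → p i j ≈ 0#) → conv p u ≈ 0#
  conv-zero zero p≈0 = p≈0 0 0
  conv-zero (suc u) p≈0 = ≈-trans (+-cong (p≈0 0 (suc u)) (conv-zero u (λ i → p≈0 (suc i)))) (+-identityˡ 0#)

  conv-+ : ∀ u (p q : ℕ → ℕ → Carrier) → conv (λ i j → p i j + q i j) u ≈ conv p u + conv q u
  conv-+ zero _ _ = ≈-refl
  conv-+ (suc u) p q = begin
    (p 0 (suc u) + q 0 (suc u)) + conv (λ i j → p (suc i) j + q (suc i) j) u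
      ≈⟨ +-congˡ (conv-+ u _ _) ⟩
    (p 0 (suc u) + q 0 (suc u)) + (conv (λ i → p (suc i)) u + conv (λ i → q (suc i)) u)
      ≈⟨ interchange _ _ _ _ ⟩
    conv p (suc u) + conv q (suc u) ∎

  conv-*ˡ : ∀ u x (p : ℕ → ℕ → Carrier) → conv (λ i j → x * p i j) u ≈ x * conv p u
  conv-*ˡ zero _ _ = ≈-refl
  conv-*ˡ (suc u) x p = ≈-trans (+-congˡ (conv-*ˡ u x _)) (≈-sym (distribˡ x _ _))

  conv-*ʳ : ∀ u x (p : ℕ → ℕ → Carrier) → conv p u * x ≈ conv (λ i j → p i j * x) u
  conv-*ʳ zero _ _ = ≈-refl
  conv-*ʳ (suc u) x p = ≈-trans (distribʳ x _ _) (+-congˡ (conv-*ʳ u x _))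

  ∑<-conv : ∀ m u (p : ℕ → ℕ → ℕ → Carrier)
    → ∑< m (λ k → conv (λ i j → p i j k) u) ≈ conv (λ i j → ∑< m (p i j)) u
  ∑<-conv m zero _ = ≈-refl
  ∑<-conv m (suc u) p = ≈-trans (∑<-+ m _ _) (+-congˡ (∑<-conv m u (p ∘ suc)))

  conv-unshift : ∀ u (p : ℕ → ℕ → Carrier) → (∀ j → p 0 j ≈ 0#) → (∀ i → p i 0 ≈ 0#)
    → conv p (suc (suc u)) ≈ conv (λ i j → p (suc i) (suc j)) u
  conv-unshift u p p0j≈0 pi0≈0 =
    ≈-trans (+-congʳ (p0j≈0 _)) (≈-trans (+-identityˡ _) (drop-j0 u (p ∘ suc) (pi0≈0 ∘ suc)))
    where
    drop-j0 : ∀ u (q : ℕ → ℕ → Carrier) → (∀ i → q i 0 ≈ 0#)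
      → conv q (suc u) ≈ conv (λ i j → q i (suc j)) u
    drop-j0 zero q qi0≈0 = ≈-trans (+-congˡ (qi0≈0 1)) (+-identityʳ _)
    drop-j0 (suc u) q qi0≈0 = +-congˡ (drop-j0 u (q ∘ suc) (qi0≈0 ∘ suc))

  ι : ℕ → Carrier
  ι m = m ·ℕ 1#

  ι-+ : ∀ m n → ι (m +ℕ n) ≈ ι m + ι n
  ι-+ = ×-homo-+ 1#

  ι-* : ∀ m n → ι (m *ℕ n) ≈ ι m * ι n
  ι-* = ×1-homo-*

  ι-conv : ∀ u (p : ℕ → ℕ → ℕ) → ι (convℕ p u) ≈ conv (λ i j → ι (p i j)) u
  ι-conv zero _ = ≈-refl
  ι-conv (suc u) p = ≈-trans (ι-+ (p 0 (suc u)) _) (+-congˡ (ι-conv u (p ∘ suc)))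

  ·ℕ≈ι* : ∀ m x → m ·ℕ x ≈ ι m * x
  ·ℕ≈ι* m x = ≈-sym (≈-trans (×-assoc-* m 1# x) (×-congʳ m (*-identityˡ x)))
    where open import Algebra.Properties.Monoid.Mult +-monoid using (×-congʳ)

  module Polynomials (d : Carrier) where
    open import Algebra.Properties.CommutativeSemigroup *-commutativeSemigroup using (x∙yz≈y∙xz)
    open import Algebra.Solver.Ring.NaturalCoefficients.Default commutativeSemiring using (solve; _:+_; _:*_; _:=_; con)

    poly : (ℕ → Carrier) → ℕ → Carrier
    poly x m = ∑< m (λ a → x a * d ^ a)

    poly-suc : ∀ m x → poly x (suc m) ≈ x 0 + d * poly (x ∘ suc) m
    poly-suc m x =
      ≈-trans (∑<-suc m _) (+-cong (*-identityʳ _) (≈-trans (∑<-cong m (λ a → x∙yz≈y∙xz _ d _)) (∑<-*ˡ m d _)))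

    poly-extend : ∀ {m n} x → m ≤ n → (∀ a → m ≤ a → x a ≈ 0#) → poly x n ≈ poly x m
    poly-extend x m≤n x≈0 = ∑<-extend _ m≤n (λ a m≤a → ≈-trans (*-congʳ (x≈0 a m≤a)) (zeroˡ _))

    cauchy : ℕ → (ℕ → Carrier) → (ℕ → Carrier) → Carrier
    cauchy m x y = ∑< m (λ k → conv (λ a b → x a * y b) k * d ^ k)

    cauchy-suc : ∀ m x y → cauchy (suc m) x y ≈ x 0 * poly y (suc m) + d * cauchy m (x ∘ suc) y
    cauchy-suc m x y = begin
      cauchy (suc m) x y
        ≈⟨ ∑<-suc m _ ⟩
      (x 0 * y 0) * 1# + ∑< m (λ k → (x 0 * y (suc k) + C k) * (d * d ^ k))
        ≈⟨ +-congˡ (∑<-cong m split) ⟩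
      (x 0 * y 0) * 1# + ∑< m (λ k → x 0 * (y (suc k) * (d * d ^ k)) + d * (C k * d ^ k))
        ≈⟨ +-congˡ (≈-trans (∑<-+ m _ _) (+-cong (∑<-*ˡ m (x 0) _) (∑<-*ˡ m d _))) ⟩
      (x 0 * y 0) * 1# + (x 0 * ∑< m (λ k → y (suc k) * (d * d ^ k)) + d * cauchy m (x ∘ suc) y)
        ≈⟨ solve 5 (λ x0 y0 S dd T →
                      (x0 :* y0) :* con 1 :+ (x0 :* S :+ dd :* T) := x0 :* (y0 :* con 1 :+ S) :+ dd :* T)
             ≈-refl (x 0) (y 0) _ d _ ⟩
      x 0 * (y 0 * 1# + ∑< m (λ k → y (suc k) * (d * d ^ k))) + d * cauchy m (x ∘ suc) y
        ≈⟨ +-congʳ (*-congˡ (≈-sym (∑<-suc m _))) ⟩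
      x 0 * poly y (suc m) + d * cauchy m (x ∘ suc) y ∎
      where
      C : ℕ → Carrier
      C = conv (λ a b → x (suc a) * y b)
      split : ∀ k → (x 0 * y (suc k) + C k) * (d * d ^ k) ≈ x 0 * (y (suc k) * (d * d ^ k)) + d * (C k * d ^ k)
      split k = solve 5 (λ x0 yk c dd e → (x0 :* yk :+ c) :* (dd :* e) := x0 :* (yk :* (dd :* e)) :+ dd :* (c :* e))
                  ≈-refl (x 0) (y (suc k)) (C k) d (d ^ k)

    cauchy≈poly*poly : ∀ A C B x y → (∀ a → A ≤ a → x a ≈ 0#) → (∀ b → C ≤ b → y b ≈ 0#)
      → A +ℕ C ≤ suc B → cauchy B x y ≈ poly x A * poly y C
    cauchy≈poly*poly zero C B x y x≈0 _ _ = ≈-trans (∑<-zero B term≈0) (≈-sym (zeroˡ _))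
      where
      term≈0 : ∀ k → conv (λ a b → x a * y b) k * d ^ k ≈ 0#
      term≈0 k =
        ≈-trans (*-congʳ (conv-zero k (λ a b → ≈-trans (*-congʳ (x≈0 a z≤n)) (zeroˡ _)))) (zeroˡ _)
    cauchy≈poly*poly (suc A) zero zero x y _ _ _ = ≈-sym (zeroʳ _)
    cauchy≈poly*poly (suc A) (suc C) zero x y _ _ (s≤s A+C<1) with () ← ℕ.m+n≤o⇒n≤o A A+C<1
    cauchy≈poly*poly (suc A) C (suc B) x y x≈0 y≈0 (s≤s A+C≤B+1) = begin
      cauchy (suc B) x y
        ≈⟨ cauchy-suc B x y ⟩
      x 0 * poly y (suc B) + d * cauchy B (x ∘ suc) y
        ≈⟨ +-cong (*-congˡ (poly-extend y (ℕ.m+n≤o⇒n≤o A A+C≤B+1) y≈0))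
                  (*-congˡ (cauchy≈poly*poly A C B (x ∘ suc) y (λ a A≤a → x≈0 (suc a) (s≤s A≤a)) y≈0 A+C≤B+1)) ⟩
      x 0 * poly y C + d * (poly (x ∘ suc) A * poly y C)
        ≈⟨ +-congˡ (*-assoc d _ _) ⟨
      x 0 * poly y C + (d * poly (x ∘ suc) A) * poly y C
        ≈⟨ distribʳ (poly y C) _ _ ⟨
      (x 0 + d * poly (x ∘ suc) A) * poly y C
        ≈⟨ *-congʳ (≈-sym (poly-suc A x)) ⟩
      poly x (suc A) * poly y C ∎

    poly-pairCount : ∀ B N (x y : ℕ → ℕ → ℕ) → (∀ i a → i ≤ a → x i a ≡ 0) → (∀ j b → j ≤ b → y j b ≡ 0)
      → N ≤ suc B → ∑< B (λ k → ι (pairCount x y N k) * d ^ k) ≈ conv (λ i j → poly (ι ∘ x i) i * poly (ι ∘ y j) j) N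
    poly-pairCount B N x y x≡0 y≡0 N≤B+1 = begin
      ∑< B (λ k → ι (pairCount x y N k) * d ^ k)
        ≈⟨ ∑<-cong B (λ k → ≈-trans (*-congʳ (ι-pairs k)) (conv-*ʳ N (d ^ k) _)) ⟩
      ∑< B (λ k → conv (λ i j → conv (λ a b → ι (x i a) * ι (y j b)) k * d ^ k) N)
        ≈⟨ ∑<-conv B N _ ⟩
      conv (λ i j → cauchy B (ι ∘ x i) (ι ∘ y j)) N
        ≈⟨ conv-cong N (λ i j i+j≡N → cauchy≈poly*poly i j B _ _ (ι≈0 x≡0 i) (ι≈0 y≡0 j)
                                         (subst (_≤ suc B) (sym i+j≡N) N≤B+1)) ⟩
      conv (λ i j → poly (ι ∘ x i) i * poly (ι ∘ y j) j) N ∎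
      where
      ι-pairs : ∀ k → ι (pairCount x y N k) ≈ conv (λ i j → conv (λ a b → ι (x i a) * ι (y j b)) k) N
      ι-pairs k = ≈-trans (ι-conv N _)
        (conv-cong N (λ i j _ → ≈-trans (ι-conv k _) (conv-cong k (λ a b _ → ι-* (x i a) (y j b)))))
      ι≈0 : ∀ {z : ℕ → ℕ → ℕ} → (∀ i a → i ≤ a → z i a ≡ 0) → ∀ i a → i ≤ a → ι (z i a) ≈ 0#
      ι≈0 z≡0 i a i≤a = reflexive (cong ι (z≡0 i a i≤a))

  _⁺ : (ℕ → Carrier) → ℕ → Carrier
  (F ⁺) zero = 0#
  (F ⁺) (suc j) = F (suc j)

  SchröderRecurrence : Carrier → (ℕ → Carrier) → Set ℓ
  SchröderRecurrence d F =
    F 0 ≈ 1# × (∀ u → F (suc u) ≈ d * conv (λ i j → F i * F j) u + conv (λ i j → F i * (F ⁺) j) u)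

  SchröderRecurrence-unique : ∀ {d F G}
    → SchröderRecurrence d F → SchröderRecurrence d G → ∀ u → F u ≈ G u
  SchröderRecurrence-unique {d} {F} {G} (F0≈1 , F-rec) (G0≈1 , G-rec) u = agree u u ℕ.≤-refl
    where
    agree : ∀ u v → v ≤ u → F v ≈ G v
    agree zero zero z≤n = ≈-trans F0≈1 (≈-sym G0≈1)
    agree (suc u) v v≤u+1 with ℕ.m≤n⇒m<n∨m≡n v≤u+1
    ... | inj₁ (s≤s v≤u) = agree u v v≤u
    ... | inj₂ refl = begin
      F (suc u)                                                                 ≈⟨ F-rec u ⟩
      d * conv (λ i j → F i * F j) u + conv (λ i j → F i * (F ⁺) j) u
        ≈⟨ +-cong (*-congˡ (conv-cong u (λ i j i+j≡u → *-cong (left i i+j≡u) (agree u j (right j i+j≡u)))))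
                  (conv-cong u (λ i j i+j≡u → *-cong (left i i+j≡u) (agree⁺ j (right j i+j≡u)))) ⟩
      d * conv (λ i j → G i * G j) u + conv (λ i j → G i * (G ⁺) j) u        ≈⟨ ≈-sym (G-rec u) ⟩
      G (suc u)                                                                 ∎
      where
      left : ∀ i {j} → i +ℕ j ≡ u → F i ≈ G i
      left i {j} i+j≡u = agree u i (subst (i ≤_) i+j≡u (ℕ.m≤m+n i j))
      right : ∀ j {i} → i +ℕ j ≡ u → j ≤ u
      right j {i} i+j≡u = subst (j ≤_) i+j≡u (ℕ.m≤n+m j i)
      agree⁺ : ∀ j → j ≤ u → (F ⁺) j ≈ (G ⁺) j
      agree⁺ zero _ = ≈-refl
      agree⁺ (suc j) = agree u (suc j)

module SchröderSeries {c ℓ : Level} (R : CommutativeRing c ℓ) (d : CommutativeRing.Carrier R)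
  (s : ℕ → ℕ → ℕ) (counts : ∀ n k → Fin (s n k) ↔ SchröderTrees n k) where
  open CommutativeRing R renaming (refl to ≈-refl; sym to ≈-sym; trans to ≈-trans)
  open import Algebra.Definitions.RawSemiring (Semiring.rawSemiring semiring) using (_^_)
  open import Algebra.Properties.CommutativeSemigroup *-commutativeSemigroup using (x∙yz≈y∙xz)
  open import Relation.Binary.Reasoning.Setoid setoid
  open Sums R
  open Polynomials d
  open Counting s counts

  schröderPoly : ℕ → Carrier
  schröderPoly n = poly (ι ∘ s n) n

  sPoly≈schröderPoly : ∀ n → sPoly R s d n ≈ schröderPoly n
  sPoly≈schröderPoly n = ∑<-cong n (λ k → ·ℕ≈ι* (s n k) (d ^ k))

  F : ℕ → Carrier
  F u = schröderPoly (suc u)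

  s-single-leaf : s 1 0 ≡ 1
  s-single-leaf = trans (s-recursion 1 0) (cong suc (cong₂ _+ℕ_ (ℕ.*-zeroʳ (s 0 0)) (ℕ.*-zeroʳ (s 1 0))))

  F-zero : F 0 ≈ 1#
  F-zero = begin
    0# + ι (s 1 0) * 1# ≈⟨ ≈-trans (+-identityˡ _) (*-identityʳ _) ⟩
    ι (s 1 0)           ≈⟨ reflexive (cong ι s-single-leaf) ⟩
    1# + 0#             ≈⟨ +-identityʳ 1# ⟩
    1#                  ∎

  binarySeries : ∀ u
    → ∑< (2 +ℕ u) (λ k → ι (binaryCount (2 +ℕ u) k) * d ^ k) ≈ d * conv (λ i j → F i * F j) u
  binarySeries u = begin
    ∑< N (λ k → ι (binaryCount N k) * d ^ k)
      ≈⟨ ≈-trans (∑<-suc (suc u) _) (≈-trans (+-congʳ (zeroˡ _)) (+-identityˡ _)) ⟩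
    ∑< (suc u) (λ k → ι (pairCount s s N k) * (d * d ^ k))
      ≈⟨ ≈-trans (∑<-cong (suc u) (λ k → x∙yz≈y∙xz _ d _)) (∑<-*ˡ (suc u) d _) ⟩
    d * ∑< (suc u) (λ k → ι (pairCount s s N k) * d ^ k)
      ≈⟨ *-congˡ (poly-pairCount (suc u) N s s s-vanishes s-vanishes ℕ.≤-refl) ⟩
    d * conv (λ i j → schröderPoly i * schröderPoly j) N
      ≈⟨ *-congˡ (conv-unshift u (λ i j → schröderPoly i * schröderPoly j) (λ _ → zeroˡ _) (λ _ → zeroʳ _)) ⟩
    d * conv (λ i j → F i * F j) u ∎
    where
    N : ℕ
    N = 2 +ℕ u

  branchingSeries : ∀ u
    → ∑< (2 +ℕ u) (λ k → ι (pairCount s s⁺ (2 +ℕ u) k) * d ^ k) ≈ conv (λ i j → F i * (F ⁺) j) u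
  branchingSeries u = begin
    ∑< N (λ k → ι (pairCount s s⁺ N k) * d ^ k)
      ≈⟨ poly-pairCount N N s s⁺ s-vanishes s⁺-vanishes (ℕ.n≤1+n N) ⟩
    conv (λ i j → schröderPoly i * poly (ι ∘ s⁺ j) j) N
      ≈⟨ conv-unshift u (λ i j → schröderPoly i * poly (ι ∘ s⁺ j) j) (λ _ → zeroˡ _) (λ _ → zeroʳ _) ⟩
    conv (λ i j → F i * poly (ι ∘ s⁺ (suc j)) (suc j)) u
      ≈⟨ conv-cong u (λ i j _ → *-congˡ (branchingPoly j)) ⟩
    conv (λ i j → F i * (F ⁺) j) u ∎
    where
    N : ℕ
    N = 2 +ℕ u
    branchingPoly : ∀ j → poly (ι ∘ s⁺ (suc j)) (suc j) ≈ (F ⁺) j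
    branchingPoly zero = ≈-trans (+-identityˡ _) (zeroˡ _)
    branchingPoly (suc j) = ≈-refl

  F-suc : ∀ u → F (suc u) ≈ d * conv (λ i j → F i * F j) u + conv (λ i j → F i * (F ⁺) j) u
  F-suc u = begin
    ∑< N (λ k → ι (s N k) * d ^ k)
      ≈⟨ ∑<-cong N (λ k → ≈-trans (*-congʳ (split k)) (distribʳ _ _ _)) ⟩
    ∑< N (λ k → ι (binaryCount N k) * d ^ k + ι (pairCount s s⁺ N k) * d ^ k)
      ≈⟨ ≈-trans (∑<-+ N _ _) (+-cong (binarySeries u) (branchingSeries u)) ⟩
    d * conv (λ i j → F i * F j) u + conv (λ i j → F i * (F ⁺) j) u ∎
    where
    N : ℕ
    N = 2 +ℕ u
    split : ∀ k → ι (s N k) ≈ ι (binaryCount N k) + ι (pairCount s s⁺ N k)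
    split k = ≈-trans (reflexive (cong ι (s-recursion N k))) (ι-+ (binaryCount N k) _)

  schröderRecurrence : SchröderRecurrence d F
  schröderRecurrence = F-zero , F-suc

module DyckSums {c ℓ : Level} (R : CommutativeRing c ℓ) (a b : CommutativeRing.Carrier R) where
  open CommutativeRing R renaming (refl to ≈-refl; sym to ≈-sym; trans to ≈-trans)
  open import Algebra.Definitions.RawSemiring (Semiring.rawSemiring semiring) using (_^_)
  open import Relation.Binary.Reasoning.Setoid setoid
  open import Algebra.Properties.CommutativeSemigroup *-commutativeSemigroup
    using () renaming (x∙yz≈y∙xz to x*yz≈y*xz)
  open import Algebra.Properties.CommutativeSemigroup +-commutativeSemigroup
    using () renaming (x∙yz≈y∙xz to x+yz≈y+xz)
  open Sums R using (conv; conv-cong; conv-+; conv-*ˡ)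

  upWeight : Bool → Carrier
  upWeight false = a
  upWeight true = b

  -- The flag records whether the previous step was D, i.e. whether a U step closes a valley.
  weight : Bool → List Step → Carrier
  weight _ [] = 1#
  weight _ (D ∷ w) = weight true w
  weight f (U ∷ w) = upWeight f * weight false w

  monomial≈weight : ∀ w → a ^ upsNotValley w * b ^ valleys w ≈ weight false w
  monomial≈weight-afterD : ∀ w → a ^ upsNotValley (D ∷ w) * b ^ valleys (D ∷ w) ≈ weight true w
  monomial≈weight [] = *-identityʳ 1#
  monomial≈weight (U ∷ w) = ≈-trans (*-assoc _ _ _) (*-congˡ (monomial≈weight w))
  monomial≈weight (D ∷ w) = monomial≈weight-afterD w
  monomial≈weight-afterD [] = *-identityʳ 1#
  monomial≈weight-afterD (U ∷ w) = begin
    a ^ upsNotValley w * (b * b ^ valleys w) ≈⟨ x*yz≈y*xz _ b _ ⟩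
    b * (a ^ upsNotValley w * b ^ valleys w) ≈⟨ *-congˡ (monomial≈weight w) ⟩
    b * weight false w                       ∎
  monomial≈weight-afterD (D ∷ w) = monomial≈weight-afterD w

  sumOver : List (List Step) → (List Step → Carrier) → Carrier
  sumOver ws g = foldr (λ w acc → g w + acc) 0# ws

  sumOver-cong : ∀ ws {g g′ : List Step → Carrier} → (∀ w → g w ≈ g′ w) → sumOver ws g ≈ sumOver ws g′
  sumOver-cong [] _ = ≈-refl
  sumOver-cong (w ∷ ws) g≈g′ = +-cong (g≈g′ w) (sumOver-cong ws g≈g′)

  sumOver-zero : ∀ ws {g : List Step → Carrier} → (∀ w → g w ≈ 0#) → sumOver ws g ≈ 0#
  sumOver-zero [] _ = ≈-refl
  sumOver-zero (w ∷ ws) g≈0 = ≈-trans (+-cong (g≈0 w) (sumOver-zero ws g≈0)) (+-identityˡ 0#)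

  sumOver-*ˡ : ∀ ws x g → sumOver ws (λ w → x * g w) ≈ x * sumOver ws g
  sumOver-*ˡ [] x _ = ≈-sym (zeroʳ x)
  sumOver-*ˡ (w ∷ ws) x g = ≈-trans (+-congˡ (sumOver-*ˡ ws x g)) (≈-sym (distribˡ x _ _))

  sumOver-++ : ∀ ws ws′ g → sumOver (ws ++ ws′) g ≈ sumOver ws g + sumOver ws′ g
  sumOver-++ [] _ _ = ≈-sym (+-identityˡ _)
  sumOver-++ (w ∷ ws) ws′ g = ≈-trans (+-congˡ (sumOver-++ ws ws′ g)) (≈-sym (+-assoc _ _ _))

  sumOver-map : ∀ ws (h : List Step → List Step) g → sumOver (map h ws) g ≡ sumOver ws (g ∘ h)
  sumOver-map [] _ _ = refl
  sumOver-map (w ∷ ws) h g = cong (g (h w) +_) (sumOver-map ws h g)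

  sumOver-filter : ∀ ws (g : List Step → Carrier)
    → sumOver (filter isDyck? ws) g ≈ sumOver ws (λ w → if isDyck w then g w else 0#)
  sumOver-filter [] _ = ≈-refl
  sumOver-filter (w ∷ ws) g with isDyck w
  ... | true = +-congˡ (sumOver-filter ws g)
  ... | false = ≈-trans (sumOver-filter ws g) (≈-sym (+-identityˡ _))

  if-*ˡ : ∀ β x y → (if β then x * y else 0#) ≈ x * (if β then y else 0#)
  if-*ˡ true _ _ = ≈-refl
  if-*ˡ false x _ = ≈-sym (zeroʳ x)

  walks : ℕ → Bool → ℕ → Carrier
  walks h f m = sumOver (words m) (λ w → if dyckFrom h w then weight f w else 0#)

  walks-suc : ∀ h f m → walks h f (suc m)
    ≈ sumOver (words m) (λ w → if dyckFrom h (U ∷ w) then weight f (U ∷ w) else 0#)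
      + sumOver (words m) (λ w → if dyckFrom h (D ∷ w) then weight f (D ∷ w) else 0#)
  walks-suc h f m = ≈-trans (sumOver-++ (map (U ∷_) (words m)) _ _)
    (+-cong (reflexive (sumOver-map (words m) (U ∷_) _)) (reflexive (sumOver-map (words m) (D ∷_) _)))

  walks-up : ∀ h f m → sumOver (words m) (λ w → if dyckFrom h (U ∷ w) then weight f (U ∷ w) else 0#)
    ≈ upWeight f * walks (suc h) false m
  walks-up zero f m =
    ≈-trans (sumOver-cong (words m) (λ w → if-*ˡ (dyckFrom 1 w) _ _)) (sumOver-*ˡ (words m) _ _)
  walks-up (suc h) f m =
    ≈-trans (sumOver-cong (words m) (λ w → if-*ˡ (dyckFrom (2 +ℕ h) w) _ _)) (sumOver-*ˡ (words m) _ _)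

  walks-suc-zero : ∀ f m → walks 0 f (suc m) ≈ upWeight f * walks 1 false m
  walks-suc-zero f m = ≈-trans (walks-suc 0 f m)
    (≈-trans (+-cong (walks-up 0 f m) (sumOver-zero (words m) (λ _ → ≈-refl))) (+-identityʳ _))

  walks-suc-suc : ∀ h f m → walks (suc h) f (suc m) ≈ upWeight f * walks (suc (suc h)) false m + walks h true m
  walks-suc-suc h f m = ≈-trans (walks-suc (suc h) f m) (+-congʳ (walks-up (suc h) f m))

  walks-short : ∀ m h f → m < h → walks h f m ≈ 0#
  walks-short zero (suc h) f _ = +-identityʳ 0#
  walks-short (suc m) (suc h) f (s≤s m<h) = ≈-trans (walks-suc-suc h f m)
    (≈-trans (+-cong (≈-trans (*-congˡ (walks-short m (2 +ℕ h) false (ℕ.≤-trans m<h (ℕ.m≤n+m h 2)))) (zeroʳ _))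
                     (walks-short m h true m<h))
             (+-identityʳ 0#))

  walks-straight : ∀ h f → walks h f h ≈ 1#
  walks-straight zero f = +-identityʳ 1#
  walks-straight (suc h) f = ≈-trans (walks-suc-suc h f h)
    (≈-trans (+-cong (≈-trans (*-congˡ (walks-short h (suc (suc h)) false (ℕ.n≤1+n (suc h)))) (zeroʳ _))
                     (walks-straight h true))
             (+-identityˡ 1#))

  -- paths h f u: walks from height h down to the axis with u up steps (hence h + 2u steps).
  paths : ℕ → Bool → ℕ → Carrier
  paths h f u = walks h f (h +ℕ 2 *ℕ u)

  paths-zero : ∀ h f → paths h f 0 ≈ 1#
  paths-zero h f = ≈-trans (reflexive (cong (walks h f) (ℕ.+-identityʳ h))) (walks-straight h f)

  paths-suc-zero : ∀ f u → paths 0 f (suc u) ≈ upWeight f * paths 1 false u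
  paths-suc-zero f u = ≈-trans (reflexive (cong (walks 0 f) (length≡ u))) (walks-suc-zero f (1 +ℕ 2 *ℕ u))
    where
    length≡ : ∀ u → 2 *ℕ suc u ≡ suc (1 +ℕ 2 *ℕ u)
    length≡ = solve-∀

  paths-suc-suc : ∀ h f u
    → paths (suc h) f (suc u) ≈ upWeight f * paths (suc (suc h)) false u + paths h true (suc u)
  paths-suc-suc h f u = ≈-trans (walks-suc-suc h f (h +ℕ 2 *ℕ suc u))
    (+-congʳ (*-congˡ (reflexive (cong (walks (suc (suc h)) false) (length≡ h u)))))
    where
    length≡ : ∀ h u → h +ℕ 2 *ℕ suc u ≡ suc (suc h) +ℕ 2 *ℕ u
    length≡ = solve-∀

  -- Cut a walk from height g + h + 1 at its first visit to height h: the part before it,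
  -- without its final D step, is a walk from height g shifted up by h + 1, and the
  -- rest starts right after a D step.
  paths-factor : ∀ u g h f → paths (suc (g +ℕ h)) f u ≈ conv (λ i j → paths g f i * paths h true j) u
  paths-factor zero g h f = ≈-trans (paths-zero (suc (g +ℕ h)) f)
    (≈-sym (≈-trans (*-cong (paths-zero g f) (paths-zero h true)) (*-identityʳ 1#)))
  paths-factor (suc u) zero h f = begin
    paths (suc h) f (suc u)
      ≈⟨ paths-suc-suc h f u ⟩
    upWeight f * paths (suc (suc h)) false u + paths h true (suc u)
      ≈⟨ ≈-trans (+-congʳ (*-congˡ (paths-factor u 1 h false))) (+-comm _ _) ⟩
    paths h true (suc u) + upWeight f * conv (λ i j → paths 1 false i * paths h true j) u
      ≈⟨ ≈-sym (+-cong (≈-trans (*-congʳ (paths-zero 0 f)) (*-identityˡ _))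
                       (≈-trans (conv-cong u (λ i j _ → ≈-trans (*-congʳ (paths-suc-zero f i)) (*-assoc _ _ _)))
                                (conv-*ˡ u _ _))) ⟩
    conv (λ i j → paths 0 f i * paths h true j) (suc u) ∎
  paths-factor (suc u) (suc g) h f = begin
    paths (suc (suc (g +ℕ h))) f (suc u)
      ≈⟨ paths-suc-suc (suc (g +ℕ h)) f u ⟩
    upWeight f * paths (suc (suc (suc (g +ℕ h)))) false u + paths (suc (g +ℕ h)) true (suc u)
      ≈⟨ +-cong (*-congˡ (paths-factor u (suc (suc g)) h false)) (paths-factor (suc u) g h true) ⟩
    upWeight f * X + (paths g true 0 * paths h true (suc u) + Y)
      ≈⟨ +-congˡ (+-congʳ (≈-trans (*-congʳ (paths-zero g true)) (*-identityˡ _))) ⟩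
    upWeight f * X + (paths h true (suc u) + Y)
      ≈⟨ x+yz≈y+xz _ _ _ ⟩
    paths h true (suc u) + (upWeight f * X + Y)
      ≈⟨ ≈-sym (+-cong (≈-trans (*-congʳ (paths-zero (suc g) f)) (*-identityˡ _))
           (≈-trans (conv-cong u (λ i j _ → ≈-trans (*-congʳ (paths-suc-suc g f i))
                                                    (≈-trans (distribʳ _ _ _) (+-congʳ (*-assoc _ _ _)))))
                    (≈-trans (conv-+ u _ _) (+-congʳ (conv-*ˡ u (upWeight f) _))))) ⟩
    conv (λ i j → paths (suc g) f i * paths h true j) (suc u) ∎
    where
    X Y : Carrier
    X = conv (λ i j → paths (suc (suc g)) false i * paths h true j) u
    Y = conv (λ i j → paths g true (suc i) * paths h true j) u

  cV≈paths : ∀ u → cV R a b (suc u) ≈ paths 0 false u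
  cV≈paths u = ≈-trans (sumOver-filter (words (2 *ℕ u)) _)
    (sumOver-cong (words (2 *ℕ u)) (λ w → if-cong (isDyck w) (monomial≈weight w)))
    where
    if-cong : ∀ β {x y} → x ≈ y → (if β then x else 0#) ≈ (if β then y else 0#)
    if-cong true x≈y = x≈y
    if-cong false _ = ≈-refl

module DyckRecurrence {c ℓ : Level} (R : CommutativeRing c ℓ) (d : CommutativeRing.Carrier R) where
  open CommutativeRing R renaming (refl to ≈-refl; sym to ≈-sym; trans to ≈-trans)
  open import Relation.Binary.Reasoning.Setoid setoid
  open import Algebra.Properties.CommutativeSemigroup *-commutativeSemigroup using (x∙yz≈y∙xz)
  open Sums R using (conv; conv-cong; conv-+; conv-*ˡ; _⁺; SchröderRecurrence)
  open DyckSums R d (d + 1#)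

  G G′ : ℕ → Carrier
  G = paths 0 false
  G′ = paths 0 true

  G-suc : ∀ u → G (suc u) ≈ d * conv (λ i j → G i * G′ j) u
  G-suc u = ≈-trans (paths-suc-zero false u) (*-congˡ (paths-factor u 0 0 false))

  G′-suc : ∀ u → G′ (suc u) ≈ (d + 1#) * conv (λ i j → G i * G′ j) u
  G′-suc u = ≈-trans (paths-suc-zero true u) (*-congˡ (paths-factor u 0 0 false))

  -- The first U step of a walk weighs d + 1 after a D step and d otherwise; later steps agree.
  d*G′≈d*G+G⁺ : ∀ j → d * G′ j ≈ d * G j + (G ⁺) j
  d*G′≈d*G+G⁺ zero =
    ≈-trans (*-congˡ (≈-trans (paths-zero 0 true) (≈-sym (paths-zero 0 false)))) (≈-sym (+-identityʳ _))
  d*G′≈d*G+G⁺ (suc j) = begin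
    d * G′ (suc j)            ≈⟨ *-congˡ (G′-suc j) ⟩
    d * ((d + 1#) * X)        ≈⟨ *-congˡ (≈-trans (distribʳ X d 1#) (+-congˡ (*-identityˡ X))) ⟩
    d * (d * X + X)           ≈⟨ distribˡ d _ _ ⟩
    d * (d * X) + d * X       ≈⟨ +-cong (*-congˡ (G-suc j)) (G-suc j) ⟨
    d * G (suc j) + G (suc j) ∎
    where
    X : Carrier
    X = conv (λ i j → G i * G′ j) j

  dyckRecurrence : SchröderRecurrence d G
  dyckRecurrence = paths-zero 0 false , λ u → begin
    G (suc u)
      ≈⟨ G-suc u ⟩
    d * conv (λ i j → G i * G′ j) u
      ≈⟨ conv-*ˡ u d _ ⟨
    conv (λ i j → d * (G i * G′ j)) u
      ≈⟨ conv-cong u (λ i j _ → ≈-trans (x∙yz≈y∙xz d (G i) (G′ j)) (*-congˡ (d*G′≈d*G+G⁺ j))) ⟩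
    conv (λ i j → G i * (d * G j + (G ⁺) j)) u
      ≈⟨ conv-cong u (λ i j _ → ≈-trans (distribˡ _ _ _) (+-congʳ (x∙yz≈y∙xz (G i) d (G j)))) ⟩
    conv (λ i j → d * (G i * G j) + G i * (G ⁺) j) u
      ≈⟨ ≈-trans (conv-+ u _ _) (+-congʳ (conv-*ˡ u d _)) ⟩
    d * conv (λ i j → G i * G j) u + conv (λ i j → G i * (G ⁺) j) u ∎

proposition9 : {c ℓ : Level} (R : CommutativeRing c ℓ)
    → (s : ℕ → ℕ → ℕ)
    → (∀ n k → Fin (s n k) ↔ SchröderTrees n k)
    → (d : CommutativeRing.Carrier R) (n : ℕ) → 1 ≤ n
    → CommutativeRing._≈_ R (sPoly R s d n)
        (cV R d (CommutativeRing._+_ R d (CommutativeRing.1# R)) n)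
proposition9 R s counts d (suc u) (s≤s z≤n) = begin
  sPoly R s d (suc u)     ≈⟨ sPoly≈schröderPoly (suc u) ⟩
  schröderPoly (suc u)    ≈⟨ SchröderRecurrence-unique schröderRecurrence dyckRecurrence u ⟩
  paths 0 false u         ≈⟨ cV≈paths u ⟨
  cV R d (d + 1#) (suc u) ∎
  where
  open CommutativeRing R using (_+_; 1#; setoid)
  open import Relation.Binary.Reasoning.Setoid setoid
  open Sums R using (SchröderRecurrence-unique)
  open SchröderSeries R d s counts using (sPoly≈schröderPoly; schröderPoly; schröderRecurrence)
  open DyckSums R d (d + 1#) using (paths; cV≈paths)
  open DyckRecurrence R d using (dyckRecurrence)
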